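{- The bipermutohedral fan $\Sigma_{E,E}$ has exactly $(2n+2)!/2^{n+1}$ chambers (maximal cones).
   Context: $E=\{0,\ldots,n\}$, $n\ge1$; $\N_{E,E}=\N_E\oplus\N_E$ with $\N_E=\mathbb R^E/\mathbb R(1,\ldots,1)$, points $(z,w)$. For $k\in E$ let $\mathscr C_k=\{(z,w):\min_{i\in E}(z_i+w_i)=z_k+w_k\}$ with coordinates $Z_i=z_i-z_k$, $W_i=-w_i+w_k$; subdivide $\mathscr C_k$ by all hyperplanes $Z_a=Z_b$, $W_a=W_b$, $Z_a=W_b$ ($a,b\in E$). The bipermutohedral fan $\Sigma_{E,E}$ is the union of these subdivisions over $k\in E$.
   Formalization: The points (z,w) realising each chamber of the bipermutohedral fan have rational coordinates rather than real ones. -}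

module Defs where

open import Data.Nat using (ℕ; suc)
open import Data.Fin using (Fin)
open import Data.Rational using (ℚ; _+_; _-_; _≤_; _<_)
open import Data.Rational.Properties using (_<?_; _≟_)
open import Data.Vec using (Vec; tabulate)
open import Data.Product using (_×_; Σ; ∃)
open import Data.Sum using (_⊎_)
open import Relation.Binary.PropositionalEquality using (_≡_; _≢_)
open import Relation.Nullary using (yes; no)
open import Data.Bool using (Bool)

data Sgn : Set where
  neg zer pos : Sgn

cmp : ℚ → ℚ → Sgn
cmp q r with q <? r
... | yes _ = neg
... | no _ with q ≟ r
... | yes _ = zer
... | no _ = pos

-- The ground set E = {0,…,n} is Fin (suc n).
-- A point (z,w) of N_{E,E} is given by representatives z w : E → ℚ
-- (all notions below are invariant under adding constants to z or to w).
Pt : ℕ → Set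
Pt n = (Fin (suc n) → ℚ) × (Fin (suc n) → ℚ)

Zc : ∀ {n} → (Fin (suc n) → ℚ) → Fin (suc n) → Fin (suc n) → ℚ
Zc z k i = z i - z k

Wc : ∀ {n} → (Fin (suc n) → ℚ) → Fin (suc n) → Fin (suc n) → ℚ
Wc w k i = w k - w i

In𝒞 : ∀ {n} → Fin (suc n) → (Fin (suc n) → ℚ) → (Fin (suc n) → ℚ) → Set
In𝒞 k z w = ∀ i → z k + w k ≤ z i + w i

-- (z,w) lies on none of the (nondegenerate) hyperplanes Z_a = Z_b, W_a = W_b,
-- Z_a = W_b of the subdivision of 𝒞_k.  (Z_a = Z_a, W_a = W_a and Z_k = W_k hold
-- identically on 𝒞_k, so they are excluded.)
Generic : ∀ {n} → Fin (suc n) → (Fin (suc n) → ℚ) → (Fin (suc n) → ℚ) → Set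
Generic k z w =
  (∀ a b → a ≢ b → Zc z k a ≢ Zc z k b) ×
  (∀ a b → a ≢ b → Wc w k a ≢ Wc w k b) ×
  (∀ a b → (a ≢ k ⊎ b ≢ k) → Zc z k a ≢ Wc w k b)

SignVec : ℕ → Set
SignVec n = Vec (Vec Sgn (suc n)) (suc n) × Vec (Vec Sgn (suc n)) (suc n)
          × Vec (Vec Sgn (suc n)) (suc n)

signVec : ∀ {n} → Fin (suc n) → (Fin (suc n) → ℚ) → (Fin (suc n) → ℚ) → SignVec n
signVec k z w =
  Data.Product._,_ (tabulate λ a → tabulate λ b → cmp (Zc z k a) (Zc z k b))
  (Data.Product._,_ (tabulate λ a → tabulate λ b → cmp (Wc w k a) (Wc w k b))
                    (tabulate λ a → tabulate λ b → cmp (Zc z k a) (Wc w k b)))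

-- A chamber (maximal cone) of Σ_{E,E} is the closure of a connected component
-- of the complement of the hyperplanes inside the interior of some 𝒞_k.  Each such
-- component is an open convex cell, determined by k and its sign vector.  We
-- encode a chamber by the pair (k, σ), and (k, σ) is a chamber iff it is realised
-- by a generic point of 𝒞_k.
Chamber : (n : ℕ) → Fin (suc n) × SignVec n → Set
Chamber n (Data.Product._,_ k σ) =
  Σ (Fin (suc n) → ℚ) λ z → Σ (Fin (suc n) → ℚ) λ w →
    In𝒞 k z w × Generic k z w × signVec k z w ≡ σ

{-# OPTIONS --safe #-}
-- On 𝒞_k the coordinates Z_i = z_i - z_k and W_i = w_k - w_i satisfy Z_k = W_k = 0, and
-- (z, w) ∈ 𝒞_k says exactly W_i ≤ Z_i for all i.  A chamber inside 𝒞_k is therefore the same thing as a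
-- total order of the 2n+1 values Z_0, …, Z_n and W_i (i ≠ k) in which W_i < Z_i: a generic point induces
-- such an order (its sign vector is the order read off pairwise), the order is recovered from the sign
-- vector because a list strictly sorted by a valuation is determined by its elements, and every order is
-- realised by the point whose coordinates are the positions in the order.  The orders are built by
-- inserting the pairs W_i < Z_i one at a time; a pair goes into an order of length 2m+1 in (2m+3 choose 2)
-- ways, so there are (2n+1)!/2^n orders for each of the n+1 choices of k, that is (2n+2)!/2^(n+1) chambers.
module Submission where

open import Defs
open import Data.Nat.Properties using (m^n≢0)
open import Data.Nat using (ℕ; suc; _≤_; _*_; _+_; _^_; _/_; _!)
open import Data.Fin using (Fin)
open import Data.Product using (_×_; Σ)
open import Data.List using (List; length)
open import Data.List.Membership.Propositional using (_∈_)
open import Data.List.Relation.Unary.Unique.Propositional using (Unique)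
open import Relation.Binary.PropositionalEquality using (_≡_)
open import Function.Bundles using (_⇔_)

open import Level using (0ℓ)
open import Function using (_∘_; id)
open import Function.Bundles using (mk⇔; Equivalence)
open import Data.Empty using (⊥-elim)
open import Data.Product using (_,_; proj₁; proj₂)
import Data.Product as Product
open import Data.Sum using (_⊎_; inj₁; inj₂; reduce)
import Data.Sum as Sum
open import Data.Sum.Properties using (≡-dec; inj₁-injective; inj₂-injective)
open import Relation.Nullary using (yes; no; contradiction)
open import Relation.Binary.Core using (Rel)
open import Relation.Binary.Definitions using (Asymmetric; Transitive; Decidable; DecidableEquality; tri<; tri≈; tri>)
open import Relation.Binary.PropositionalEquality
  using (_≢_; refl; sym; trans; cong; cong₂; subst; subst₂; ≢-sym; setoid; module ≡-Reasoning)

open import Data.Nat using (zero; _<_; z<s; s<s)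
open import Data.Nat.Properties using (*-suc; *-distribˡ-+; +-comm)
open import Data.Nat.DivMod using (m*n/n≡m)
open import Data.Nat.Combinatorics using (_C_; nC1≡n; nCk+nC[k+1]≡[n+1]C[k+1])
open import Data.Nat.Solver using () renaming (module +-*-Solver to ℕ-Solver)
import Data.Integer as ℤ
import Data.Integer.Properties as ℤ
open import Data.Rational as ℚ using (ℚ; *<*)
import Data.Rational.Properties as ℚ
open import Data.Rational.Literals using (fromℤ)
open import Data.Rational.Solver using (module +-*-Solver)
import Data.Fin as Fin
open import Data.Fin using (punchIn; punchOut)
open import Data.Fin.Properties using (punchIn-punchOut; punchInᵢ≢i; punchIn-injective)
open import Data.Vec using (Vec; tabulate; lookup)
open import Data.Vec.Properties using (lookup∘tabulate; tabulate-cong)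

open import Data.List using ([]; _∷_; [_]; _++_; map; concatMap; foldr; allFin)
open import Data.List.Properties using (length-++; length-map; length-tabulate; ∷-injectiveˡ; ∷-injectiveʳ)
open import Data.List.Membership.Propositional using (_∉_; find; lose)
open import Data.List.Membership.Propositional.Properties
  using (∈-map⁻; ∈-map⁺; ∈-++⁻; ∈-++⁺ˡ; ∈-++⁺ʳ; ∈-concatMap⁻; ∈-concatMap⁺; ∈-allFin)
open import Data.List.Relation.Unary.Any using (here; there)
open import Data.List.Relation.Unary.All as All using (All; []; _∷_)
open import Data.List.Relation.Unary.AllPairs as AllPairs using (AllPairs; []; _∷_)
import Data.List.Relation.Unary.AllPairs.Properties as AllPairs
import Data.List.Relation.Unary.Unique.Propositional.Properties as Unique
open import Data.List.Relation.Binary.Disjoint.Propositional using (Disjoint)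
open import Data.List.Relation.Binary.Sublist.Propositional using (_⊆_; _∷ʳ_)
import Data.List.Relation.Binary.Sublist.Propositional as Sublist
import Data.List.Relation.Binary.Pointwise as Pointwise
open import Data.List.Relation.Binary.Permutation.Propositional using (_↭_; ↭-refl; ↭-trans; ↭-prep; ↭-sym; ↭⇒↭ₛ)
open import Data.List.Relation.Binary.Permutation.Propositional.Properties using (All-resp-↭; ∈-resp-↭; ↭-length)
import Data.List.Relation.Binary.Permutation.Setoid.Properties as PermutationSetoid
open import Data.List.Relation.Ternary.Interleaving.Propositional
  using (Interleaving; []; consˡ; consʳ; right; toPermutation)

open Equivalence using (to; from)

module _ {A B : Set} (f : A → List B) where

  length-concatMap-const : ∀ {c} xs → (∀ {x} → x ∈ xs → length (f x) ≡ c) →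
                           length (concatMap f xs) ≡ length xs * c
  length-concatMap-const []       _    = refl
  length-concatMap-const (x ∷ xs) |f|≡c =
    trans (length-++ (f x)) (cong₂ _+_ (|f|≡c (here refl)) (length-concatMap-const xs (|f|≡c ∘ there)))

  concatMap-unique : ∀ {xs} → Unique xs → (∀ {x} → x ∈ xs → Unique (f x)) →
                     (∀ {x y v} → x ∈ xs → y ∈ xs → v ∈ f x → v ∈ f y → x ≡ y) →
                     Unique (concatMap f xs)
  concatMap-unique {[]}     []            _       _        = []
  concatMap-unique {x ∷ xs} (x∉xs ∷ !xs) !f separate =
    Unique.++⁺ (!f (here refl)) (concatMap-unique !xs (!f ∘ there) (λ p q → separate (there p) (there q))) disjoint
    where
      disjoint : Disjoint (f x) (concatMap f xs)
      disjoint (v∈fx , v∈rest) with find (∈-concatMap⁻ f v∈rest)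
      ... | y , y∈xs , v∈fy = All.lookup x∉xs y∈xs (separate (here refl) (there y∈xs) v∈fx v∈fy)

module _ {A : Set} where

  AllPairs-connex : ∀ {R : Rel A 0ℓ} {xs x y} → AllPairs R xs → x ∈ xs → y ∈ xs → x ≡ y ⊎ R x y ⊎ R y x
  AllPairs-connex (_   ∷ _)  (here refl) (here refl) = inj₁ refl
  AllPairs-connex (x<ys ∷ _) (here refl) (there y∈)  = inj₂ (inj₁ (All.lookup x<ys y∈))
  AllPairs-connex (y<xs ∷ _) (there x∈)  (here refl) = inj₂ (inj₂ (All.lookup y<xs x∈))
  AllPairs-connex (_   ∷ rs) (there x∈)  (there y∈)  = AllPairs-connex rs x∈ y∈

  AllPairs-mapWith∈ : ∀ {R S : Rel A 0ℓ} {xs} → (∀ {x y} → x ∈ xs → y ∈ xs → R x y → S x y) →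
                      AllPairs R xs → AllPairs S xs
  AllPairs-mapWith∈ f []         = []
  AllPairs-mapWith∈ f (rx ∷ rxs) =
    All.tabulate (λ y∈ → f (here refl) (there y∈) (All.lookup rx y∈)) ∷
    AllPairs-mapWith∈ (λ x∈ y∈ → f (there x∈) (there y∈)) rxs

  AllPairs-⊆ : ∀ {R : Rel A 0ℓ} {xs x y} → (x ∷ y ∷ []) ⊆ xs → AllPairs R xs → R x y
  AllPairs-⊆ (_ ∷ʳ xy⊆)          (_ ∷ rs)    = AllPairs-⊆ xy⊆ rs
  AllPairs-⊆ (refl Sublist.∷ y⊆) (x<xs ∷ _) = All.lookup x<xs (Sublist.lookup y⊆ (here refl))

  module _ {R : Rel A 0ℓ} (asym : Asymmetric R) where

    AllPairs-≡ : ∀ {xs ys} → AllPairs R xs → AllPairs R ys →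
                 (∀ {z} → z ∈ xs → z ∈ ys) → (∀ {z} → z ∈ ys → z ∈ xs) → xs ≡ ys
    AllPairs-≡ []       []       _     _     = refl
    AllPairs-≡ []       (_ ∷ _)  _     ys⊆xs with () ← ys⊆xs (here refl)
    AllPairs-≡ (_ ∷ _)  []       xs⊆ys _     with () ← xs⊆ys (here refl)
    AllPairs-≡ {x ∷ xs} {y ∷ ys} (x<xs ∷ rxs) (y<ys ∷ rys) xs⊆ys ys⊆xs
      with xs⊆ys (here refl) | ys⊆xs (here refl)
    ... | here refl | _ = cong (x ∷_) (AllPairs-≡ rxs rys (shrink x<xs xs⊆ys) (shrink y<ys ys⊆xs))
      where
        shrink : ∀ {us vs} → All (R x) us → (∀ {z} → z ∈ x ∷ us → z ∈ x ∷ vs) → ∀ {z} → z ∈ us → z ∈ vs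
        shrink x<us us⊆ z∈ with us⊆ (there z∈)
        ... | here refl = ⊥-elim (asym (All.lookup x<us z∈) (All.lookup x<us z∈))
        ... | there z∈vs = z∈vs
    ... | there x∈ys | here refl = ⊥-elim (asym (All.lookup y<ys x∈ys) (All.lookup y<ys x∈ys))
    ... | there x∈ys | there y∈xs = ⊥-elim (asym (All.lookup x<xs y∈xs) (All.lookup y<ys x∈ys))

module _ {A : Set} where

  interleaving-⊆ˡ : ∀ {l r v : List A} → Interleaving l r v → l ⊆ v
  interleaving-⊆ˡ []         = Sublist.[]
  interleaving-⊆ˡ (consˡ sp) = refl Sublist.∷ interleaving-⊆ˡ sp
  interleaving-⊆ˡ (consʳ sp) = _ ∷ʳ interleaving-⊆ˡ sp

  interleaving-⊆ʳ : ∀ {l r v : List A} → Interleaving l r v → r ⊆ v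
  interleaving-⊆ʳ []         = Sublist.[]
  interleaving-⊆ʳ (consˡ sp) = _ ∷ʳ interleaving-⊆ʳ sp
  interleaving-⊆ʳ (consʳ sp) = refl Sublist.∷ interleaving-⊆ʳ sp

  interleaving-determines-right : ∀ {l r₁ r₂ v : List A} → Disjoint l r₁ → Disjoint l r₂ →
                                  Interleaving l r₁ v → Interleaving l r₂ v → r₁ ≡ r₂
  interleaving-determines-right _  _  []          []          = refl
  interleaving-determines-right d₁ d₂ (consˡ sp₁) (consˡ sp₂) =
    interleaving-determines-right (λ (p , q) → d₁ (there p , q)) (λ (p , q) → d₂ (there p , q)) sp₁ sp₂
  interleaving-determines-right d₁ d₂ (consʳ sp₁) (consʳ sp₂) =
    cong (_ ∷_) (interleaving-determines-right (λ (p , q) → d₁ (p , there q)) (λ (p , q) → d₂ (p , there q)) sp₁ sp₂)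
  interleaving-determines-right _  d₂ (consˡ _)   (consʳ _)   = ⊥-elim (d₂ (here refl , here refl))
  interleaving-determines-right d₁ _  (consʳ _)   (consˡ _)   = ⊥-elim (d₁ (here refl , here refl))

  insertions : A → List A → List (List A)
  insertions c []       = [ [ c ] ]
  insertions c (y ∷ ys) = (c ∷ y ∷ ys) ∷ map (y ∷_) (insertions c ys)

  pairInsertions : A → A → List A → List (List A)
  pairInsertions a b []       = [ a ∷ b ∷ [] ]
  pairInsertions a b (y ∷ ys) = map (a ∷_) (insertions b (y ∷ ys)) ++ map (y ∷_) (pairInsertions a b ys)

  ∈-insertions⇒interleaving : ∀ {c u v} → v ∈ insertions c u → Interleaving [ c ] u v
  ∈-insertions⇒interleaving {u = []}     (here refl) = consˡ []
  ∈-insertions⇒interleaving {u = y ∷ ys} (here refl) = consˡ (right (Pointwise.refl refl))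
  ∈-insertions⇒interleaving {u = y ∷ ys} (there v∈) with ∈-map⁻ (y ∷_) v∈
  ... | _ , v∈′ , refl = consʳ (∈-insertions⇒interleaving v∈′)

  ∈-pairInsertions⇒interleaving : ∀ {a b u v} → v ∈ pairInsertions a b u → Interleaving (a ∷ b ∷ []) u v
  ∈-pairInsertions⇒interleaving {u = []} (here refl) = consˡ (consˡ [])
  ∈-pairInsertions⇒interleaving {a} {b} {y ∷ ys} v∈ with ∈-++⁻ (map (a ∷_) (insertions b (y ∷ ys))) v∈
  ... | inj₁ v∈ˡ with ∈-map⁻ (a ∷_) v∈ˡ
  ...   | _ , v∈′ , refl = consˡ (∈-insertions⇒interleaving v∈′)
  ∈-pairInsertions⇒interleaving {a} {b} {y ∷ ys} v∈ | inj₂ v∈ʳ with ∈-map⁻ (y ∷_) v∈ʳ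
  ...   | _ , v∈′ , refl = consʳ (∈-pairInsertions⇒interleaving v∈′)

  length-insertions : ∀ c u → length (insertions c u) ≡ suc (length u)
  length-insertions c []       = refl
  length-insertions c (y ∷ ys) = cong suc (trans (length-map (y ∷_) (insertions c ys)) (length-insertions c ys))

  length-pairInsertions : ∀ a b u → length (pairInsertions a b u) ≡ suc (suc (length u)) C 2
  length-pairInsertions a b []       = refl
  length-pairInsertions a b (y ∷ ys) = begin
    length (map (a ∷_) (insertions b (y ∷ ys)) ++ map (y ∷_) (pairInsertions a b ys))
      ≡⟨ length-++ (map (a ∷_) (insertions b (y ∷ ys))) ⟩
    length (map (a ∷_) (insertions b (y ∷ ys))) + length (map (y ∷_) (pairInsertions a b ys))
      ≡⟨ cong₂ _+_ (length-map (a ∷_) (insertions b (y ∷ ys))) (length-map (y ∷_) (pairInsertions a b ys)) ⟩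
    length (insertions b (y ∷ ys)) + length (pairInsertions a b ys)
      ≡⟨ cong₂ _+_ (trans (length-insertions b (y ∷ ys)) (sym (nC1≡n L))) (length-pairInsertions a b ys) ⟩
    L C 1 + L C 2
      ≡⟨ nCk+nC[k+1]≡[n+1]C[k+1] L 1 ⟩
    suc L C 2 ∎
    where
      open ≡-Reasoning
      L = suc (suc (length ys))

  prefixed-unique : ∀ {a b} {xss yss : List (List A)} → a ≢ b → Unique xss → Unique yss →
                    Unique (map (a ∷_) xss ++ map (b ∷_) yss)
  prefixed-unique {a} {b} a≢b !xss !yss =
    Unique.++⁺ (Unique.map⁺ ∷-injectiveʳ !xss) (Unique.map⁺ ∷-injectiveʳ !yss) heads-differ
    where
      heads-differ : Disjoint (map (a ∷_) _) (map (b ∷_) _)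
      heads-differ (v∈ˡ , v∈ʳ) with ∈-map⁻ (a ∷_) v∈ˡ | ∈-map⁻ (b ∷_) v∈ʳ
      ... | _ , _ , refl | _ , _ , eq = a≢b (∷-injectiveˡ eq)

  insertions-unique : ∀ {c u} → c ∉ u → Unique (insertions c u)
  insertions-unique {u = []}     _   = [] ∷ []
  insertions-unique {u = y ∷ ys} c∉u =
    -- insertions c (y ∷ ys) is definitionally map (c ∷_) [ y ∷ ys ] ++ map (y ∷_) (insertions c ys)
    prefixed-unique (λ c≡y → c∉u (here c≡y)) ([] ∷ []) (insertions-unique (c∉u ∘ there))

  pairInsertions-unique : ∀ {a b u} → a ∉ u → b ∉ u → Unique (pairInsertions a b u)
  pairInsertions-unique {u = []}     _   _   = [] ∷ []
  pairInsertions-unique {u = y ∷ ys} a∉u b∉u =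
    prefixed-unique (λ a≡y → a∉u (here a≡y)) (insertions-unique b∉u) (pairInsertions-unique (a∉u ∘ there) (b∉u ∘ there))

module InsertionSort {A : Set} {_<_ : Rel A 0ℓ} (_<?_ : Decidable _<_) where

  insert : A → List A → List A
  insert x []       = [ x ]
  insert x (y ∷ ys) with x <? y
  ... | yes _ = x ∷ y ∷ ys
  ... | no  _ = y ∷ insert x ys

  sort : List A → List A
  sort = foldr insert []

  insert-∈-insertions : ∀ x u → insert x u ∈ insertions x u
  insert-∈-insertions x []       = here refl
  insert-∈-insertions x (y ∷ ys) with x <? y
  ... | yes _ = here refl
  ... | no  _ = there (∈-map⁺ (y ∷_) (insert-∈-insertions x ys))

  insert-↭ : ∀ x u → insert x u ↭ x ∷ u
  insert-↭ x u = toPermutation (∈-insertions⇒interleaving (insert-∈-insertions x u))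

  sort-↭ : ∀ xs → sort xs ↭ xs
  sort-↭ []       = ↭-refl
  sort-↭ (x ∷ xs) = ↭-trans (insert-↭ x (sort xs)) (↭-prep x (sort-↭ xs))

  insert-pair : ∀ {a b} → a < b → ∀ u → insert a (insert b u) ∈ pairInsertions a b u
  insert-pair {a} {b} a<b [] with a <? b
  ... | yes _   = here refl
  ... | no  a≮b = contradiction a<b a≮b
  insert-pair {a} {b} a<b (y ∷ ys) with b <? y
  ... | yes _ with a <? b
  ...   | yes _   = ∈-++⁺ˡ {xs = map (a ∷_) (insertions b (y ∷ ys))} (here refl)
  ...   | no  a≮b = contradiction a<b a≮b
  insert-pair {a} {b} a<b (y ∷ ys) | no _ with a <? y
  ...   | yes _ = ∈-++⁺ˡ {xs = map (a ∷_) (insertions b (y ∷ ys))}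
                          (∈-map⁺ (a ∷_) (there (∈-map⁺ (y ∷_) (insert-∈-insertions b ys))))
  ...   | no  _ = ∈-++⁺ʳ (map (a ∷_) (insertions b (y ∷ ys))) (∈-map⁺ (y ∷_) (insert-pair a<b ys))

  module _ (<-trans : Transitive _<_) where

    insert-sorted : ∀ {x u} → (∀ {y} → y ∈ u → x < y ⊎ y < x) → AllPairs _<_ u → AllPairs _<_ (insert x u)
    insert-sorted {x} {[]}     _        []              = [] ∷ []
    insert-sorted {x} {y ∷ ys} x≶u (y<ys ∷ sorted) with x <? y
    ... | yes x<y = (x<y ∷ All.map (<-trans x<y) y<ys) ∷ y<ys ∷ sorted
    ... | no  x≮y with x≶u (here refl)
    ...   | inj₁ x<y = contradiction x<y x≮y
    ...   | inj₂ y<x = All-resp-↭ (↭-sym (insert-↭ x ys)) (y<x ∷ y<ys) ∷ insert-sorted (x≶u ∘ there) sorted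

    sort-sorted : ∀ {xs} → AllPairs (λ x y → x < y ⊎ y < x) xs → AllPairs _<_ (sort xs)
    sort-sorted {[]}     []              = []
    sort-sorted {x ∷ xs} (x≶xs ∷ ≶xs) =
      insert-sorted (λ y∈ → All.lookup x≶xs (∈-resp-↭ (sort-↭ xs) y∈)) (sort-sorted ≶xs)

module _ {A : Set} (_≟_ : DecidableEquality A) where

  position : A → List A → ℕ
  position x []       = 0
  position x (y ∷ ys) with x ≟ y
  ... | yes _ = 0
  ... | no  _ = suc (position x ys)

  position-head : ∀ y ys → position y (y ∷ ys) ≡ 0
  position-head y ys with y ≟ y
  ... | yes _   = refl
  ... | no  y≢y = contradiction refl y≢y

  position-tail : ∀ {x y} ys → x ≢ y → position x (y ∷ ys) ≡ suc (position x ys)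
  position-tail {x} {y} ys x≢y with x ≟ y
  ... | yes x≡y = contradiction x≡y x≢y
  ... | no  _   = refl

  position-increasing : ∀ {u} → Unique u → AllPairs (λ s t → position s u < position t u) u
  position-increasing {[]}     []             = []
  position-increasing {y ∷ ys} (y∉ys ∷ !ys) =
    All.tabulate (λ t∈ → subst₂ _<_ (sym (position-head y ys)) (sym (position-tail ys (≢-sym (All.lookup y∉ys t∈)))) z<s) ∷
    AllPairs-mapWith∈ (λ s∈ t∈ s<t → subst₂ _<_ (sym (position-tail ys (≢-sym (All.lookup y∉ys s∈))))
                                                 (sym (position-tail ys (≢-sym (All.lookup y∉ys t∈)))) (s<s s<t))
                      (position-increasing !ys)

fromℕ : ℕ → ℚ
fromℕ m = fromℤ (ℤ.+ m)

fromℕ-mono-< : ∀ {i j} → i < j → fromℕ i ℚ.< fromℕ j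
fromℕ-mono-< {i} {j} i<j = *<* (subst₂ ℤ._<_ (sym (ℤ.*-identityʳ (ℤ.+ i))) (sym (ℤ.*-identityʳ (ℤ.+ j))) (ℤ.+<+ i<j))

flipSgn : Sgn → Sgn
flipSgn neg = pos
flipSgn zer = zer
flipSgn pos = neg

module _ {q r : ℚ} where

  cmp-< : q ℚ.< r → cmp q r ≡ neg
  cmp-< q<r with q ℚ.<? r
  ... | yes _   = refl
  ... | no  q≮r = contradiction q<r q≮r

  cmp-> : r ℚ.< q → cmp q r ≡ pos
  cmp-> r<q with q ℚ.<? r
  ... | yes q<r = ⊥-elim (ℚ.<-asym q<r r<q)
  ... | no  _ with q ℚ.≟ r
  ...   | yes refl = ⊥-elim (ℚ.<-irrefl refl r<q)
  ...   | no  _    = refl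

  cmp≡neg⇒< : cmp q r ≡ neg → q ℚ.< r
  cmp≡neg⇒< eq with q ℚ.<? r
  ... | yes q<r = q<r
  ... | no  _ with q ℚ.≟ r
  cmp≡neg⇒< () | no _ | yes _
  cmp≡neg⇒< () | no _ | no _

cmp-refl : ∀ q → cmp q q ≡ zer
cmp-refl q with q ℚ.<? q
... | yes q<q = ⊥-elim (ℚ.<-irrefl refl q<q)
... | no  _ with q ℚ.≟ q
...   | yes _   = refl
...   | no  q≢q = contradiction refl q≢q

cmp-flip : ∀ q r → cmp r q ≡ flipSgn (cmp q r)
cmp-flip q r with ℚ.<-cmp q r
... | tri< q<r _ _ = trans (cmp-> q<r) (cong flipSgn (sym (cmp-< q<r)))
... | tri≈ _ refl _ = trans (cmp-refl q) (cong flipSgn (sym (cmp-refl q)))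
... | tri> _ _ r<q = trans (cmp-< r<q) (cong flipSgn (sym (cmp-> r<q)))

cmp-swap : ∀ {q r q′ r′} → cmp q r ≡ cmp q′ r′ → cmp r q ≡ cmp r′ q′
cmp-swap {q} {r} {q′} {r′} eq = trans (cmp-flip q r) (trans (cong flipSgn eq) (sym (cmp-flip q′ r′)))

<-resp-cmp : ∀ {q r q′ r′} → cmp q r ≡ cmp q′ r′ → q ℚ.< r → q′ ℚ.< r′
<-resp-cmp eq q<r = cmp≡neg⇒< (trans (sym eq) (cmp-< q<r))

≢⇒≶ : ∀ {q r} → q ≢ r → q ℚ.< r ⊎ r ℚ.< q
≢⇒≶ {q} {r} q≢r with ℚ.<-cmp q r
... | tri< q<r _ _ = inj₁ q<r
... | tri≈ _ q≡r _ = contradiction q≡r q≢r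
... | tri> _ _ r<q = inj₂ r<q

module _ {A : Set} {f g : A → ℚ} where

  sorted-cmp-agree : ∀ {xs x y} → AllPairs (λ s t → f s ℚ.< f t) xs → AllPairs (λ s t → g s ℚ.< g t) xs →
                     x ∈ xs → y ∈ xs → cmp (f x) (f y) ≡ cmp (g x) (g y)
  sorted-cmp-agree {x = x} fs gs x∈ y∈ with AllPairs-connex (AllPairs.zip (fs , gs)) x∈ y∈
  ... | inj₁ refl                   = trans (cmp-refl (f x)) (sym (cmp-refl (g x)))
  ... | inj₂ (inj₁ (fx<fy , gx<gy)) = trans (cmp-< fx<fy) (sym (cmp-< gx<gy))
  ... | inj₂ (inj₂ (fy<fx , gy<gx)) = trans (cmp-> fy<fx) (sym (cmp-> gy<gx))

≤∧≢⇒< : ∀ {q r} → q ℚ.≤ r → q ≢ r → q ℚ.< r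
≤∧≢⇒< q≤r q≢r with ≢⇒≶ q≢r
... | inj₁ q<r = q<r
... | inj₂ r<q = ⊥-elim (ℚ.<-irrefl refl (ℚ.<-≤-trans r<q q≤r))

signMatrix : ∀ {n} → (Fin n → ℚ) → (Fin n → ℚ) → Vec (Vec Sgn n) n
signMatrix x y = tabulate λ a → tabulate λ b → cmp (x a) (y b)

module _ {n} (x y x′ y′ : Fin n → ℚ) where

  signMatrix-≡⇔ : signMatrix x y ≡ signMatrix x′ y′ ⇔ (∀ a b → cmp (x a) (y b) ≡ cmp (x′ a) (y′ b))
  signMatrix-≡⇔ = mk⇔ (λ eq a b → trans (sym (lookup-signMatrix x y a b))
                                        (trans (cong (λ M → lookup (lookup M a) b) eq) (lookup-signMatrix x′ y′ a b)))
                      (λ same → tabulate-cong λ a → tabulate-cong (same a))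
    where
      lookup-signMatrix : ∀ p q a b → lookup (lookup (signMatrix p q) a) b ≡ cmp (p a) (q b)
      lookup-signMatrix p q a b = trans (cong (λ r → lookup r b) (lookup∘tabulate _ a)) (lookup∘tabulate _ b)

module _ {n : ℕ} (k : Fin (suc n)) (z w : Fin (suc n) → ℚ) where

  In𝒞⇔W≤Z : In𝒞 k z w ⇔ (∀ i → Wc w k i ℚ.≤ Zc z k i)
  In𝒞⇔W≤Z = mk⇔ (λ inC i → subst₂ ℚ._≤_ (shiftˡ i) (shiftʳ i) (ℚ.+-monoˡ-≤ (ℚ.- z k ℚ.- w i) (inC i)))
                (λ W≤Z i → subst₂ ℚ._≤_ (unshiftˡ i) (unshiftʳ i) (ℚ.+-monoˡ-≤ (z k ℚ.+ w i) (W≤Z i)))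
    where
      open +-*-Solver
      shiftˡ : ∀ i → (z k ℚ.+ w k) ℚ.+ (ℚ.- z k ℚ.- w i) ≡ w k ℚ.- w i
      shiftˡ i = solve 3 (λ zk wk wi → (zk :+ wk) :+ (:- zk :- wi) := wk :- wi) refl (z k) (w k) (w i)
      shiftʳ : ∀ i → (z i ℚ.+ w i) ℚ.+ (ℚ.- z k ℚ.- w i) ≡ z i ℚ.- z k
      shiftʳ i = solve 3 (λ zi wi zk → (zi :+ wi) :+ (:- zk :- wi) := zi :- zk) refl (z i) (w i) (z k)
      unshiftˡ : ∀ i → (w k ℚ.- w i) ℚ.+ (z k ℚ.+ w i) ≡ z k ℚ.+ w k
      unshiftˡ i = solve 3 (λ zk wk wi → (wk :- wi) :+ (zk :+ wi) := zk :+ wk) refl (z k) (w k) (w i)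
      unshiftʳ : ∀ i → (z i ℚ.- z k) ℚ.+ (z k ℚ.+ w i) ≡ z i ℚ.+ w i
      unshiftʳ i = solve 3 (λ zi wi zk → (zi :- zk) :+ (zk :+ wi) := zi :+ wi) refl (z i) (w i) (z k)

Token : ℕ → Set
Token n = Fin (suc n) ⊎ Fin (suc n)

pattern Z i = inj₁ i
pattern W i = inj₂ i

_≟ₜ_ : ∀ {n} → DecidableEquality (Token n)
_≟ₜ_ = ≡-dec Fin._≟_ Fin._≟_

orderCount : ℕ → ℕ
orderCount zero    = 1
orderCount (suc m) = orderCount m * ((3 + 2 * m) C 2)

module Orders {n : ℕ} (k : Fin (suc n)) where

  -- On 𝒞_k both Z_k and W_k vanish, so W_k is represented by the token Z k.
  Ŵ : Fin (suc n) → Token n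
  Ŵ b with b Fin.≟ k
  ... | yes _ = Z k
  ... | no  _ = W b

  Ŵ-k : Ŵ k ≡ Z k
  Ŵ-k with k Fin.≟ k
  ... | yes _   = refl
  ... | no  k≢k = contradiction refl k≢k

  Ŵ-≢ : ∀ {b} → b ≢ k → Ŵ b ≡ W b
  Ŵ-≢ {b} b≢k with b Fin.≟ k
  ... | yes b≡k = contradiction b≡k b≢k
  ... | no  _   = refl

  Ŵ-injective : ∀ {a b} → a ≢ b → Ŵ a ≢ Ŵ b
  Ŵ-injective {a} {b} a≢b with a Fin.≟ k | b Fin.≟ k
  ... | yes refl | yes refl = λ _ → a≢b refl
  ... | yes _    | no  _    = λ ()
  ... | no  _    | yes _    = λ ()
  ... | no  _    | no  _    = a≢b ∘ inj₂-injective

  Z≢Ŵ⇔ : ∀ {a b} → Z a ≢ Ŵ b ⇔ (a ≢ k ⊎ b ≢ k)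
  Z≢Ŵ⇔ {a} {b} with b Fin.≟ k
  ... | no b≢k   = mk⇔ (λ _ → inj₂ b≢k) (λ _ ())
  ... | yes refl = mk⇔ (λ Za≢Zk → inj₁ (Za≢Zk ∘ cong Z)) λ where
    (inj₁ a≢k) → a≢k ∘ inj₁-injective
    (inj₂ k≢k) → contradiction refl k≢k

  data Coordinate : Token n → Set where
    Z-coordinate : ∀ a → Coordinate (Z a)
    W-coordinate : ∀ b → Coordinate (Ŵ b)

  others : List (Fin (suc n))
  others = map (punchIn k) (allFin n)

  ∈-others : ∀ {i} → i ≢ k → i ∈ others
  ∈-others i≢k =
    subst (_∈ others) (punchIn-punchOut (≢-sym i≢k)) (∈-map⁺ (punchIn k) (∈-allFin (punchOut (≢-sym i≢k))))

  others-≢ : ∀ {i} → i ∈ others → i ≢ k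
  others-≢ i∈ with ∈-map⁻ (punchIn k) i∈
  ... | j , _ , refl = punchInᵢ≢i k j

  k∉others : k ∉ others
  k∉others k∈ = others-≢ k∈ refl

  others-unique : Unique others
  others-unique = Unique.map⁺ (punchIn-injective k _ _) (Unique.allFin⁺ n)

  length-others : length others ≡ n
  length-others = trans (length-map (punchIn k) (allFin n)) (length-tabulate _)

  tokens : List (Fin (suc n)) → List (Token n)
  tokens []       = [ Z k ]
  tokens (i ∷ is) = W i ∷ Z i ∷ tokens is

  length-tokens : ∀ is → length (tokens is) ≡ 1 + 2 * length is
  length-tokens []       = refl
  length-tokens (i ∷ is) = trans (cong (2 +_) (length-tokens is)) (cong suc (sym (*-suc 2 (length is))))

  ∈-tokens⁻ : ∀ {is t} → t ∈ tokens is → t ≡ Z k ⊎ reduce t ∈ is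
  ∈-tokens⁻ {[]}     (here refl)         = inj₁ refl
  ∈-tokens⁻ {i ∷ is} (here refl)         = inj₂ (here refl)
  ∈-tokens⁻ {i ∷ is} (there (here refl)) = inj₂ (here refl)
  ∈-tokens⁻ {i ∷ is} (there (there t∈))  = Sum.map₂ there (∈-tokens⁻ t∈)

  Zk-∈-tokens : ∀ is → Z k ∈ tokens is
  Zk-∈-tokens []       = here refl
  Zk-∈-tokens (i ∷ is) = there (there (Zk-∈-tokens is))

  WZ-∈-tokens : ∀ {is i} → i ∈ is → W i ∈ tokens is × Z i ∈ tokens is
  WZ-∈-tokens (here refl) = here refl , there (here refl)
  WZ-∈-tokens (there i∈)  = Product.map (there ∘ there) (there ∘ there) (WZ-∈-tokens i∈)

  coordinate⇒∈-tokens : ∀ {t} → Coordinate t → t ∈ tokens others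
  coordinate⇒∈-tokens (Z-coordinate a) with a Fin.≟ k
  ... | yes refl = Zk-∈-tokens others
  ... | no  a≢k  = proj₂ (WZ-∈-tokens (∈-others a≢k))
  coordinate⇒∈-tokens (W-coordinate b) with b Fin.≟ k
  ... | yes refl = Zk-∈-tokens others
  ... | no  b≢k  = proj₁ (WZ-∈-tokens (∈-others b≢k))

  ∈-tokens⇒coordinate : ∀ {t} → t ∈ tokens others → Coordinate t
  ∈-tokens⇒coordinate {Z a} _  = Z-coordinate a
  ∈-tokens⇒coordinate {W b} W∈ with ∈-tokens⁻ W∈
  ... | inj₂ b∈ = subst Coordinate (Ŵ-≢ (others-≢ b∈)) (W-coordinate b)

  fresh : ∀ {i is t} → i ≢ k → All (i ≢_) is → t ∈ tokens is → i ≢ reduce t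
  fresh i≢k i∉is t∈ with ∈-tokens⁻ t∈
  ... | inj₁ refl = i≢k
  ... | inj₂ t∈is = All.lookup i∉is t∈is

  tokens-unique : ∀ {is} → Unique is → k ∉ is → Unique (tokens is)
  tokens-unique {[]}     []            _   = [] ∷ []
  tokens-unique {i ∷ is} (i∉is ∷ !is) k∉ =
    ((λ ()) ∷ All.tabulate (λ t∈ W≡t → fresh i≢k i∉is t∈ (cong reduce W≡t))) ∷
    All.tabulate (λ t∈ Z≡t → fresh i≢k i∉is t∈ (cong reduce Z≡t)) ∷
    tokens-unique !is (k∉ ∘ there)
    where
      i≢k : i ≢ k
      i≢k i≡k = k∉ (here (sym i≡k))

  -- orders is lists the arrangements of tokens is in which W i precedes Z i for every i ∈ is;
  -- for is = others these are the chambers inside 𝒞_k, read as orders of the coordinates.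
  orders : List (Fin (suc n)) → List (List (Token n))
  orders []       = [ tokens [] ]
  orders (i ∷ is) = concatMap (pairInsertions (W i) (Z i)) (orders is)

  ∈-orders-step : ∀ {i is u} → u ∈ orders (i ∷ is) →
                  Σ (List (Token n)) λ u′ → u′ ∈ orders is × Interleaving (W i ∷ Z i ∷ []) u′ u
  ∈-orders-step {i} {is} u∈ with find (∈-concatMap⁻ (pairInsertions (W i) (Z i)) {xs = orders is} u∈)
  ... | u′ , u′∈ , u∈′ = u′ , u′∈ , ∈-pairInsertions⇒interleaving u∈′

  orders-↭ : ∀ {is u} → u ∈ orders is → u ↭ tokens is
  orders-↭ {[]}     (here refl) = ↭-refl
  orders-↭ {i ∷ is} u∈ with ∈-orders-step {i} {is} u∈
  ... | u′ , u′∈ , sp = ↭-trans (toPermutation sp) (↭-prep (W i) (↭-prep (Z i) (orders-↭ {is} u′∈)))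

  orders-⊆ : ∀ {is u i} → u ∈ orders is → i ∈ is → (W i ∷ Z i ∷ []) ⊆ u
  orders-⊆ {i ∷ is} u∈ i∈ with ∈-orders-step {i} {is} u∈
  orders-⊆ {i ∷ is} u∈ (here refl) | _ , _   , sp = interleaving-⊆ˡ sp
  orders-⊆ {i ∷ is} u∈ (there j∈)  | _ , u′∈ , sp = Sublist.⊆-trans (orders-⊆ {is} u′∈ j∈) (interleaving-⊆ʳ sp)

  orders-unique : ∀ {is} → Unique is → k ∉ is → Unique (orders is)
  orders-unique {[]}     _             _   = [] ∷ []
  orders-unique {i ∷ is} (i∉is ∷ !is) k∉ =
    concatMap-unique (pairInsertions (W i) (Z i)) (orders-unique !is (k∉ ∘ there))
      (λ u∈ → pairInsertions-unique (λ W∈ → fresh-pair u∈ (here refl , W∈))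
                                    (λ Z∈ → fresh-pair u∈ (there (here refl) , Z∈)))
      (λ u₁∈ u₂∈ v∈₁ v∈₂ → interleaving-determines-right (fresh-pair u₁∈) (fresh-pair u₂∈)
                             (∈-pairInsertions⇒interleaving v∈₁) (∈-pairInsertions⇒interleaving v∈₂))
    where
      i≢k : i ≢ k
      i≢k i≡k = k∉ (here (sym i≡k))
      fresh-pair : ∀ {u} → u ∈ orders is → Disjoint (W i ∷ Z i ∷ []) u
      fresh-pair u∈ (here refl         , t∈u) = fresh i≢k i∉is (∈-resp-↭ (orders-↭ {is} u∈) t∈u) refl
      fresh-pair u∈ (there (here refl) , t∈u) = fresh i≢k i∉is (∈-resp-↭ (orders-↭ {is} u∈) t∈u) refl

  orders-length : ∀ is → length (orders is) ≡ orderCount (length is)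
  orders-length []       = refl
  orders-length (i ∷ is) = begin
    length (concatMap (pairInsertions (W i) (Z i)) (orders is))
      ≡⟨ length-concatMap-const (pairInsertions (W i) (Z i)) (orders is) length-step ⟩
    length (orders is) * ((3 + 2 * length is) C 2)
      ≡⟨ cong (_* ((3 + 2 * length is) C 2)) (orders-length is) ⟩
    orderCount (length (i ∷ is)) ∎
    where
      open ≡-Reasoning
      length-step : ∀ {u} → u ∈ orders is → length (pairInsertions (W i) (Z i) u) ≡ (3 + 2 * length is) C 2
      length-step {u} u∈ = trans (length-pairInsertions (W i) (Z i) u)
                                 (cong (λ l → (2 + l) C 2) (trans (↭-length (orders-↭ {is} u∈)) (length-tokens is)))

  order-unique : ∀ {u} → u ∈ orders others → Unique u
  order-unique u∈ = PermutationSetoid.Unique-resp-↭ (setoid (Token n)) (↭⇒↭ₛ (↭-sym (orders-↭ {others} u∈)))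
                                                    (tokens-unique others-unique k∉others)

  coordinate-∈ : ∀ {u t} → u ∈ orders others → Coordinate t → t ∈ u
  coordinate-∈ u∈ = ∈-resp-↭ (↭-sym (orders-↭ {others} u∈)) ∘ coordinate⇒∈-tokens

  signVecOf : (Token n → ℚ) → SignVec n
  signVecOf v = signMatrix (v ∘ Z) (v ∘ Z) , signMatrix (v ∘ Ŵ) (v ∘ Ŵ) , signMatrix (v ∘ Z) (v ∘ Ŵ)

  module _ (v v′ : Token n → ℚ) where

    signVecOf-cong : (∀ {s t} → Coordinate s → Coordinate t → cmp (v s) (v t) ≡ cmp (v′ s) (v′ t)) →
                     signVecOf v ≡ signVecOf v′
    signVecOf-cong same =
      cong₂ _,_
        (from (signMatrix-≡⇔ (v ∘ Z) (v ∘ Z) (v′ ∘ Z) (v′ ∘ Z)) λ a b → same (Z-coordinate a) (Z-coordinate b))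
        (cong₂ _,_
          (from (signMatrix-≡⇔ (v ∘ Ŵ) (v ∘ Ŵ) (v′ ∘ Ŵ) (v′ ∘ Ŵ)) λ a b → same (W-coordinate a) (W-coordinate b))
          (from (signMatrix-≡⇔ (v ∘ Z) (v ∘ Ŵ) (v′ ∘ Z) (v′ ∘ Ŵ)) λ a b → same (Z-coordinate a) (W-coordinate b)))

    signVecOf-cmp : signVecOf v ≡ signVecOf v′ →
                    ∀ {s t} → Coordinate s → Coordinate t → cmp (v s) (v t) ≡ cmp (v′ s) (v′ t)
    signVecOf-cmp eq (Z-coordinate a) (Z-coordinate b) =
      to (signMatrix-≡⇔ (v ∘ Z) (v ∘ Z) (v′ ∘ Z) (v′ ∘ Z)) (cong proj₁ eq) a b
    signVecOf-cmp eq (W-coordinate a) (W-coordinate b) =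
      to (signMatrix-≡⇔ (v ∘ Ŵ) (v ∘ Ŵ) (v′ ∘ Ŵ) (v′ ∘ Ŵ)) (cong (proj₁ ∘ proj₂) eq) a b
    signVecOf-cmp eq (Z-coordinate a) (W-coordinate b) =
      to (signMatrix-≡⇔ (v ∘ Z) (v ∘ Ŵ) (v′ ∘ Z) (v′ ∘ Ŵ)) (cong (proj₂ ∘ proj₂) eq) a b
    signVecOf-cmp eq (W-coordinate a) (Z-coordinate b) =
      cmp-swap {v (Z b)} {v (Ŵ a)} {v′ (Z b)} {v′ (Ŵ a)}
               (to (signMatrix-≡⇔ (v ∘ Z) (v ∘ Ŵ) (v′ ∘ Z) (v′ ∘ Ŵ)) (cong (proj₂ ∘ proj₂) eq) b a)

  signVec≡signVecOf : ∀ z w v → (∀ a → Zc z k a ≡ v (Z a)) → (∀ b → Wc w k b ≡ v (Ŵ b)) →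
                      signVec k z w ≡ signVecOf v
  signVec≡signVecOf z w v Z≡ W≡ =
    cong₂ _,_
      (from (signMatrix-≡⇔ (Zc z k) (Zc z k) (v ∘ Z) (v ∘ Z)) λ a b → cong₂ cmp (Z≡ a) (Z≡ b))
      (cong₂ _,_
        (from (signMatrix-≡⇔ (Wc w k) (Wc w k) (v ∘ Ŵ) (v ∘ Ŵ)) λ a b → cong₂ cmp (W≡ a) (W≡ b))
        (from (signMatrix-≡⇔ (Zc z k) (Wc w k) (v ∘ Z) (v ∘ Ŵ)) λ a b → cong₂ cmp (Z≡ a) (W≡ b)))

  rank : List (Token n) → Token n → ℚ
  rank u t = fromℕ (position _≟ₜ_ t u) ℚ.- fromℕ (position _≟ₜ_ (Z k) u)

  rank-sorted : ∀ {u} → Unique u → AllPairs (λ s t → rank u s ℚ.< rank u t) u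
  rank-sorted {u} !u =
    AllPairs.map (ℚ.+-monoˡ-< (ℚ.- fromℕ (position _≟ₜ_ (Z k) u)) ∘ fromℕ-mono-<) (position-increasing _≟ₜ_ !u)

  rank-injective : ∀ {u s t} → Unique u → s ∈ u → t ∈ u → s ≢ t → rank u s ≢ rank u t
  rank-injective !u s∈ t∈ s≢t with AllPairs-connex (rank-sorted !u) s∈ t∈
  ... | inj₁ s≡t        = contradiction s≡t s≢t
  ... | inj₂ (inj₁ s<t) = ℚ.<⇒≢ s<t
  ... | inj₂ (inj₂ t<s) = ≢-sym (ℚ.<⇒≢ t<s)

  rank-signVecOf-injective : ∀ {u₁ u₂} → u₁ ∈ orders others → u₂ ∈ orders others →
                             signVecOf (rank u₁) ≡ signVecOf (rank u₂) → u₁ ≡ u₂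
  rank-signVecOf-injective {u₁} {u₂} u₁∈ u₂∈ eq =
    AllPairs-≡ ℚ.<-asym u₁-sorted-by-rank₂ (rank-sorted (order-unique u₂∈)) (move u₁∈ u₂∈) (move u₂∈ u₁∈)
    where
      move : ∀ {u u′ t} → u ∈ orders others → u′ ∈ orders others → t ∈ u → t ∈ u′
      move u∈ u′∈ = ∈-resp-↭ (↭-trans (orders-↭ {others} u∈) (↭-sym (orders-↭ {others} u′∈)))
      coordinate : ∀ {t} → t ∈ u₁ → Coordinate t
      coordinate t∈ = ∈-tokens⇒coordinate (∈-resp-↭ (orders-↭ {others} u₁∈) t∈)
      u₁-sorted-by-rank₂ : AllPairs (λ s t → rank u₂ s ℚ.< rank u₂ t) u₁
      u₁-sorted-by-rank₂ = AllPairs-mapWith∈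
        (λ s∈ t∈ → <-resp-cmp (signVecOf-cmp (rank u₁) (rank u₂) eq (coordinate s∈) (coordinate t∈)))
                                             (rank-sorted (order-unique u₁∈))

  -- The point whose coordinates Z_a, W_b on 𝒞_k are the positions of Z a, Ŵ b in u relative to Z k.
  canonicalZ canonicalW : List (Token n) → Fin (suc n) → ℚ
  canonicalZ u a = fromℕ (position _≟ₜ_ (Z a) u)
  canonicalW u b = ℚ.- fromℕ (position _≟ₜ_ (Ŵ b) u)

  Wc-canonical : ∀ u b → Wc (canonicalW u) k b ≡ rank u (Ŵ b)
  Wc-canonical u b = begin
    ℚ.- P (Ŵ k) ℚ.- ℚ.- P (Ŵ b) ≡⟨ cong (λ t → ℚ.- P t ℚ.- ℚ.- P (Ŵ b)) Ŵ-k ⟩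
    ℚ.- P (Z k) ℚ.- ℚ.- P (Ŵ b) ≡⟨ solve 2 (λ p q → (:- p) :- (:- q) := q :- p) refl (P (Z k)) (P (Ŵ b)) ⟩
    P (Ŵ b) ℚ.- P (Z k)         ∎
    where
      open ≡-Reasoning
      open +-*-Solver
      P : Token n → ℚ
      P t = fromℕ (position _≟ₜ_ t u)

  canonical-realises : ∀ {u} → u ∈ orders others → Chamber n (k , signVecOf (rank u))
  canonical-realises {u} u∈ =
    canonicalZ u , canonicalW u , in𝒞 , generic ,
    signVec≡signVecOf (canonicalZ u) (canonicalW u) (rank u) (λ _ → refl) (Wc-canonical u)
    where
      !u = order-unique u∈
      separated : ∀ {s t} → Coordinate s → Coordinate t → s ≢ t → rank u s ≢ rank u t
      separated cs ct = rank-injective !u (coordinate-∈ u∈ cs) (coordinate-∈ u∈ ct)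
      Ŵ≤Z : ∀ i → rank u (Ŵ i) ℚ.≤ rank u (Z i)
      Ŵ≤Z i with i Fin.≟ k
      ... | yes refl = ℚ.≤-refl
      ... | no  i≢k  = ℚ.<⇒≤ (AllPairs-⊆ (orders-⊆ {others} u∈ (∈-others i≢k)) (rank-sorted !u))
      in𝒞 : In𝒞 k (canonicalZ u) (canonicalW u)
      in𝒞 = from (In𝒞⇔W≤Z k (canonicalZ u) (canonicalW u)) λ i →
        subst (ℚ._≤ rank u (Z i)) (sym (Wc-canonical u i)) (Ŵ≤Z i)
      generic : Generic k (canonicalZ u) (canonicalW u)
      generic = (λ a b a≢b → separated (Z-coordinate a) (Z-coordinate b) (a≢b ∘ inj₁-injective))
              , (λ a b a≢b eq → separated (W-coordinate a) (W-coordinate b) (Ŵ-injective a≢b)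
                                  (trans (sym (Wc-canonical u a)) (trans eq (Wc-canonical u b))))
              , (λ a b a∨b≢k eq → separated (Z-coordinate a) (W-coordinate b) (from Z≢Ŵ⇔ a∨b≢k)
                                    (trans eq (Wc-canonical u b)))

  module _ (v : Token n → ℚ) where
    open InsertionSort (λ s t → v s ℚ.<? v t)

    sort-∈-orders : ∀ is → (∀ {i} → i ∈ is → v (W i) ℚ.< v (Z i)) → sort (tokens is) ∈ orders is
    sort-∈-orders []       _   = here refl
    sort-∈-orders (i ∷ is) W<Z = ∈-concatMap⁺ (pairInsertions (W i) (Z i))
      (lose (sort-∈-orders is (W<Z ∘ there)) (insert-pair (W<Z (here refl)) (sort (tokens is))))

  coordinates : (z w : Fin (suc n) → ℚ) → Token n → ℚ
  coordinates z w (Z a) = Zc z k a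
  coordinates z w (W b) = Wc w k b

  coordinates-Ŵ : ∀ z w b → coordinates z w (Ŵ b) ≡ Wc w k b
  coordinates-Ŵ z w b with b Fin.≟ k
  ... | yes refl = trans (ℚ.+-inverseʳ (z k)) (sym (ℚ.+-inverseʳ (w k)))
  ... | no  _    = refl

  Chamber⇒order : ∀ {σ} → Chamber n (k , σ) →
                  Σ (List (Token n)) λ u → u ∈ orders others × signVecOf (rank u) ≡ σ
  Chamber⇒order (z , w , in𝒞 , (Z-generic , W-generic , ZW-generic) , refl) =
    u , u∈ , trans (signVecOf-cong (rank u) v λ cs ct → sorted-cmp-agree (rank-sorted (order-unique u∈)) u-sorted
                                                                         (coordinate-∈ u∈ cs) (coordinate-∈ u∈ ct))
                   (sym (signVec≡signVecOf z w v (λ _ → refl) (sym ∘ coordinates-Ŵ z w)))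
    where
      v = coordinates z w
      open InsertionSort (λ s t → v s ℚ.<? v t)
      u = sort (tokens others)
      u∈ : u ∈ orders others
      u∈ = sort-∈-orders v others λ i∈ →
        ≤∧≢⇒< (to (In𝒞⇔W≤Z k z w) in𝒞 _) (≢-sym (ZW-generic _ _ (inj₁ (others-≢ i∈))))
      separated : ∀ {s t} → Coordinate s → Coordinate t → s ≢ t → v s ≢ v t
      separated (Z-coordinate a) (Z-coordinate b) s≢t = Z-generic a b (s≢t ∘ cong Z)
      separated (W-coordinate a) (W-coordinate b) s≢t =
        subst₂ _≢_ (sym (coordinates-Ŵ z w a)) (sym (coordinates-Ŵ z w b)) (W-generic a b (s≢t ∘ cong Ŵ))
      separated (Z-coordinate a) (W-coordinate b) s≢t =
        subst (Zc z k a ≢_) (sym (coordinates-Ŵ z w b)) (ZW-generic a b (to Z≢Ŵ⇔ s≢t))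
      separated (W-coordinate a) (Z-coordinate b) s≢t =
        subst (_≢ Zc z k b) (sym (coordinates-Ŵ z w a)) (≢-sym (ZW-generic b a (to Z≢Ŵ⇔ (≢-sym s≢t))))
      u-sorted : AllPairs (λ s t → v s ℚ.< v t) u
      u-sorted = sort-sorted ℚ.<-trans (AllPairs-mapWith∈
        (λ s∈ t∈ s≢t → ≢⇒≶ (separated (∈-tokens⇒coordinate s∈) (∈-tokens⇒coordinate t∈) s≢t))
        (tokens-unique others-unique k∉others))

  chambersIn : List (Fin (suc n) × SignVec n)
  chambersIn = map (λ u → k , signVecOf (rank u)) (orders others)

  ∈-chambersIn⇒Chamber : ∀ {c} → c ∈ chambersIn → Chamber n c
  ∈-chambersIn⇒Chamber c∈ with ∈-map⁻ _ c∈
  ... | _ , u∈ , refl = canonical-realises u∈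

  ∈-chambersIn⇒proj₁ : ∀ {c} → c ∈ chambersIn → proj₁ c ≡ k
  ∈-chambersIn⇒proj₁ c∈ with ∈-map⁻ _ c∈
  ... | _ , _ , refl = refl

  Chamber⇒∈-chambersIn : ∀ {σ} → Chamber n (k , σ) → (k , σ) ∈ chambersIn
  Chamber⇒∈-chambersIn ch with Chamber⇒order ch
  ... | _ , u∈ , refl = ∈-map⁺ _ u∈

  chambersIn-unique : Unique chambersIn
  chambersIn-unique = AllPairs.map⁺ (AllPairs-mapWith∈
    (λ u₁∈ u₂∈ u₁≢u₂ eq → u₁≢u₂ (rank-signVecOf-injective u₁∈ u₂∈ (cong proj₂ eq)))
    (orders-unique others-unique k∉others))

  length-chambersIn : length chambersIn ≡ orderCount n
  length-chambersIn = trans (length-map _ (orders others)) (trans (orders-length others) (cong orderCount length-others))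

choose-2 : ∀ m → 2 * (suc m C 2) ≡ suc m * m
choose-2 zero    = refl
choose-2 (suc m) = begin
  2 * (suc (suc m) C 2)              ≡⟨ cong (2 *_) (sym (nCk+nC[k+1]≡[n+1]C[k+1] (suc m) 1)) ⟩
  2 * (suc m C 1 + suc m C 2)        ≡⟨ *-distribˡ-+ 2 (suc m C 1) (suc m C 2) ⟩
  2 * (suc m C 1) + 2 * (suc m C 2)  ≡⟨ cong₂ _+_ (cong (2 *_) (nC1≡n (suc m))) (choose-2 m) ⟩
  2 * suc m + suc m * m              ≡⟨ solve 1 (λ m → con 2 :* (con 1 :+ m) :+ (con 1 :+ m) :* m
                                                   := (con 2 :+ m) :* (con 1 :+ m)) refl m ⟩
  suc (suc m) * suc m                ∎
  where
    open ≡-Reasoning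
    open ℕ-Solver

orderCount-factorial : ∀ m → orderCount m * 2 ^ m ≡ (1 + 2 * m) !
orderCount-factorial zero    = refl
orderCount-factorial (suc m) = begin
  orderCount m * c * (2 * 2 ^ m)          ≡⟨ solve 3 (λ a c p → a :* c :* (con 2 :* p) := a :* p :* (con 2 :* c)) refl
                                                     (orderCount m) c (2 ^ m) ⟩
  orderCount m * 2 ^ m * (2 * c)          ≡⟨ cong₂ _*_ (orderCount-factorial m) (choose-2 (2 + 2 * m)) ⟩
  (1 + 2 * m) ! * ((3 + 2 * m) * (2 + 2 * m)) ≡⟨ solve 2 (λ f m → f :* ((con 3 :+ con 2 :* m) :* (con 2 :+ con 2 :* m))
                                                          := (con 3 :+ con 2 :* m) :* ((con 2 :+ con 2 :* m) :* f))
                                                  refl ((1 + 2 * m) !) m ⟩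
  (3 + 2 * m) !                           ≡⟨ cong (λ j → suc j !) (sym (*-suc 2 m)) ⟩
  (1 + 2 * suc m) !                       ∎
  where
    open ≡-Reasoning
    open ℕ-Solver
    c = (3 + 2 * m) C 2

chamberCount : ∀ n → suc n * orderCount n ≡ _/_ ((2 * n + 2) !) (2 ^ (n + 1)) {{m^n≢0 2 (n + 1)}}
chamberCount n = sym (begin
  _/_ ((2 * n + 2) !) (2 ^ (n + 1)) {{m^n≢0 2 (n + 1)}}
    ≡⟨ cong (λ x → _/_ x (2 ^ (n + 1)) {{m^n≢0 2 (n + 1)}}) factorial-split ⟩
  _/_ (suc n * orderCount n * 2 ^ (n + 1)) (2 ^ (n + 1)) {{m^n≢0 2 (n + 1)}}
    ≡⟨ m*n/n≡m (suc n * orderCount n) (2 ^ (n + 1)) {{m^n≢0 2 (n + 1)}} ⟩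
  suc n * orderCount n ∎)
  where
    open ≡-Reasoning
    open ℕ-Solver
    factorial-split : (2 * n + 2) ! ≡ suc n * orderCount n * 2 ^ (n + 1)
    factorial-split = begin
      (2 * n + 2) !                          ≡⟨ cong _! (+-comm (2 * n) 2) ⟩
      (2 + 2 * n) * (1 + 2 * n) !            ≡⟨ cong ((2 + 2 * n) *_) (sym (orderCount-factorial n)) ⟩
      (2 + 2 * n) * (orderCount n * 2 ^ n)   ≡⟨ solve 3 (λ n a p → (con 2 :+ con 2 :* n) :* (a :* p)
                                                              := (con 1 :+ n) :* a :* (con 2 :* p)) refl n (orderCount n) (2 ^ n) ⟩
      suc n * orderCount n * 2 ^ (1 + n)     ≡⟨ cong (λ e → suc n * orderCount n * 2 ^ e) (+-comm 1 n) ⟩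
      suc n * orderCount n * 2 ^ (n + 1)     ∎

proposition2p13 : (n : ℕ) → 1 ≤ n →
    Σ (List (Fin (suc n) × SignVec n)) λ L →
      Unique L × (∀ c → (c ∈ L) ⇔ Chamber n c) ×
      length L ≡ _/_ ((2 * n + 2) !) (2 ^ (n + 1)) {{m^n≢0 2 (n + 1)}}
proposition2p13 n _ =
  chambers , chambers-unique , (λ c → mk⇔ ∈-chambers⇒Chamber (Chamber⇒∈-chambers c)) , chambers-length
  where
    chambers : List (Fin (suc n) × SignVec n)
    chambers = concatMap Orders.chambersIn (allFin (suc n))

    chambers-unique : Unique chambers
    chambers-unique = concatMap-unique Orders.chambersIn (Unique.allFin⁺ (suc n)) (λ _ → Orders.chambersIn-unique _)
      (λ _ _ c∈₁ c∈₂ → trans (sym (Orders.∈-chambersIn⇒proj₁ _ c∈₁)) (Orders.∈-chambersIn⇒proj₁ _ c∈₂))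

    ∈-chambers⇒Chamber : ∀ {c} → c ∈ chambers → Chamber n c
    ∈-chambers⇒Chamber c∈ with find (∈-concatMap⁻ Orders.chambersIn {xs = allFin (suc n)} c∈)
    ... | k , _ , c∈ₖ = Orders.∈-chambersIn⇒Chamber k c∈ₖ

    Chamber⇒∈-chambers : ∀ c → Chamber n c → c ∈ chambers
    Chamber⇒∈-chambers (k , _) ch = ∈-concatMap⁺ Orders.chambersIn (lose (∈-allFin k) (Orders.Chamber⇒∈-chambersIn k ch))

    chambers-length : length chambers ≡ _/_ ((2 * n + 2) !) (2 ^ (n + 1)) {{m^n≢0 2 (n + 1)}}
    chambers-length = begin
      length chambers
        ≡⟨ length-concatMap-const Orders.chambersIn (allFin (suc n)) (λ {k} _ → Orders.length-chambersIn k) ⟩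
      length (allFin (suc n)) * orderCount n ≡⟨ cong (_* orderCount n) (length-tabulate {n = suc n} id) ⟩
      suc n * orderCount n              ≡⟨ chamberCount n ⟩
      _/_ ((2 * n + 2) !) (2 ^ (n + 1)) {{m^n≢0 2 (n + 1)}} ∎
      where open ≡-Reasoning
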